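{- Let $A$ be a finite set of $k \geq 3$ positive integers, let $r$ be a positive integer, and let $H=\{h_1,\ldots,h_t\}$ with $h_1<h_2<\cdots<h_t$ be a set of $t \geq 2$ positive integers such that $1 \leq r \leq \max(H) \leq (k-1)r-1$. Then \[ |H^{(r)}A| \geq \mathcal{L}_k(H,r). \] Moreover, this lower bound is best possible: there exist such sets $A$ and $H$ for which equality holds.
   Context: For a finite set $A=\{a_1,\ldots,a_k\}$ of integers and positive integers $h, r$, the generalized $h$-fold sumset is $h^{(r)}A=\{\sum_{i=1}^k \lambda_i a_i : 0\le \lambda_i\le r,\ \sum_{i=1}^k\lambda_i=h\}$, i.e. the set of sums of $h$ elements of $A$ in which each element is used at most $r$ times. For a finite set $H$ of positive integers, $H^{(r)}A=\bigcup_{h\in H} h^{(r)}A$. For a set $H=\{h_1<\cdots<h_t\}$ of positive integers, a positive integer $r$ and an integer $k$, put $h_0=0$ and, for $0\le i\le t$, write $h_i=m_i r+\epsilon_i$ with $m_i=\lfloor h_i/r\rfloor$ and $0\le \epsilon_i\le r-1$. Define \[\mathcal{L}_k(H,r)=\sum_{i=1}^{t}\Big( r(m_i-m_{i-1})(k-m_i)+(\epsilon_i-\epsilon_{i-1})(k-m_i-1)-\max\{\epsilon_i,\epsilon_{i-1}\}(m_i-m_{i-1})+1\Big).\] -}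

module Defs where

open import Data.Nat using (ℕ; zero; suc; _+_; _*_; _⊔_; _∸_; _≤_; _<_; NonZero)
open import Data.Product using (_×_)
open import Data.List.Relation.Unary.All using (All)
open import Data.List.Relation.Unary.Unique.Propositional using (Unique)
open import Data.List.Relation.Unary.Linked using (Linked)
open import Data.Nat.DivMod using (_/_; _%_)
import Data.Nat.Properties as ℕP
open import Data.Integer as ℤ using (ℤ; +_)
open import Data.List using (List; []; _∷_; map; filter; zipWith; concatMap; length; deduplicate; foldr)
open import Data.Nat.ListAction using (sum)
open import Relation.Binary.PropositionalEquality using (_≡_)

upTo≤ : ℕ → List ℕ
upTo≤ zero = 0 ∷ []
upTo≤ (suc r) = 0 ∷ map suc (upTo≤ r)

coeffs : (r k : ℕ) → List (List ℕ)
coeffs r zero = [] ∷ []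
coeffs r (suc k) = concatMap (λ x → map (x ∷_) (coeffs r k)) (upTo≤ r)

-- h^{(r)}A as a list (possibly with repetitions) of the sums Σ λᵢ aᵢ,
-- 0 ≤ λᵢ ≤ r, Σ λᵢ = h.  A is given as a list a₁,…,aₖ of distinct elements.
hSumsetList : (h r : ℕ) → List ℕ → List ℕ
hSumsetList h r A =
  map (λ ls → sum (zipWith _*_ ls A))
      (filter (λ ls → sum ls ℕP.≟ h) (coeffs r (length A)))

HSumsetList : (H : List ℕ) (r : ℕ) → List ℕ → List ℕ
HSumsetList H r A = concatMap (λ h → hSumsetList h r A) H

cardHSumset : (H : List ℕ) (r : ℕ) → List ℕ → ℕ
cardHSumset H r A = length (deduplicate ℕP._≟_ (HSumsetList H r A))

maxList : List ℕ → ℕ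
maxList = foldr _⊔_ 0

-- One summand of 𝓛_k(H,r), for consecutive h_{i-1} = hp, h_i = h.
Lterm : (k r : ℕ) .{{_ : NonZero r}} → (hp h : ℕ) → ℤ
Lterm k r hp h =
    (+ r) ℤ.* (mi ℤ.- mp) ℤ.* ((+ k) ℤ.- mi)
  ℤ.+ (ei ℤ.- ep) ℤ.* ((+ k) ℤ.- mi ℤ.- + 1)
  ℤ.- (ei ℤ.⊔ ep) ℤ.* (mi ℤ.- mp)
  ℤ.+ + 1
  where
    mi = + (h / r)
    mp = + (hp / r)
    ei = + (h % r)
    ep = + (hp % r)

Lgo : (k r : ℕ) .{{_ : NonZero r}} → (prev : ℕ) → List ℕ → ℤ
Lgo k r prev [] = + 0
Lgo k r prev (h ∷ hs) = Lterm k r prev h ℤ.+ Lgo k r h hs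

-- 𝓛_k(H,r) for H = h₁ < ⋯ < h_t given as the increasing list, with h₀ = 0.
𝓛 : (k : ℕ) (H : List ℕ) (r : ℕ) .{{_ : NonZero r}} → ℤ
𝓛 k H r = Lgo k r 0 H

ValidA : (k : ℕ) → List ℕ → Set
ValidA k A = Unique A × length A ≡ k × All (λ a → 1 ≤ a) A

ValidH : (k r : ℕ) → List ℕ → Set
ValidH k r H = Linked _<_ H × 2 ≤ length H × All (λ h → 1 ≤ h) H ×
               r ≤ maxList H × maxList H ≤ (k ∸ 1) * r ∸ 1

{-# OPTIONS --safe #-}
module Submission where

-- Sort A as b₁ < ⋯ < b_k and write elements of h^{(r)}A as Σ cᵢ bᵢ with 0 ≤ cᵢ ≤ r and Σ cᵢ = h.
-- For h = ε + m r with 0 ≤ ε < r the largest one has c = (0, …, 0, ε, r, …, r).  For consecutive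
-- h' < h in 0, h₁, …, h_t we find elements of h^{(r)}A in (max h'^{(r)}A, max h^{(r)}A]; these
-- windows are disjoint.  Start from S = (r, …, r, b, 0, …, 0, ε', r, …, r), the maximal vector of h'
-- with h − h' added at the bottom, whose value beats max h'^{(r)}A by summation by parts; then
-- repeatedly move one unit one position up (onto an entry < r) until the maximal vector of h is
-- reached.  Each move raises Σ cᵢ bᵢ and raises the first moment Σ i cᵢ by exactly one, so this
-- yields (difference of first moments) + 1 values: exactly the summand of 𝓛 when ε' ≤ ε, and more
-- when h − h' borrows in base r (ε' > ε).  Equality holds for A = {1, …, k} and H = {r, r + 1}:
-- every such sum lies in [r, k (r + 1)), an interval with exactly 𝓛 elements.

open import Data.Integer as ℤ using (ℤ; +_)
import Data.Integer.Properties as ℤP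
import Data.Integer.Tactic.RingSolver as ℤ-Solver
open import Data.List using (List; []; _∷_; _++_; map; zipWith; length; replicate; deduplicate; downFrom; applyUpTo)
open import Data.List.Membership.Propositional using (_∈_; find)
open import Data.List.Membership.Propositional.Properties
open import Data.List.Properties using (length-++; length-replicate; length-map; length-downFrom; length-applyUpTo)
open import Data.List.Relation.Binary.Permutation.Propositional as ↭ using (_↭_; prep; swap)
open import Data.List.Relation.Binary.Permutation.Propositional.Properties using (All-resp-↭; ↭-length)
open import Data.List.Relation.Binary.Subset.Propositional using (_⊆_)
open import Data.List.Relation.Unary.All as All using (All; []; _∷_)
import Data.List.Relation.Unary.All.Properties as All
open import Data.List.Relation.Unary.Any as Any using (here; there)
open import Data.List.Relation.Unary.Linked as Linked using (Linked; []; [-]; _∷_)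
open import Data.List.Relation.Unary.Unique.Propositional using (Unique; []; _∷_)
import Data.List.Relation.Unary.Unique.Propositional.Properties as Unique
open import Data.Nat using (ℕ; zero; suc; pred; _+_; _*_; _∸_; _≤_; _<_; z≤n; s≤s; z<s; NonZero; >-nonZero⁻¹; _≟_; _<?_)
open import Data.Nat.DivMod using (_/_; _%_; m≡m%n+[m/n]*n; m%n<n; m<n*o⇒m/o<n; /-monoˡ-≤; n/n≡1; n%n≡0; [m+n]%n≡m%n; m/n≡1+[m∸n]/n)
open import Data.Nat.ListAction using (sum)
open import Data.Nat.ListAction.Properties using (sum-++; sum-↭)
open import Data.Nat.Properties
import Data.Nat.Tactic.RingSolver as ℕ-Solver
open import Data.Product using (Σ; ∃; _×_; _,_; proj₁; proj₂)
open import Data.Sum using (inj₁; inj₂)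
open import Defs
open import Function using (_∘_)
open import Relation.Binary.PropositionalEquality as ≡
open import Relation.Nullary using (contradiction; yes; no)

open import Algebra.Properties.AbelianGroup ℤP.+-0-abelianGroup using (∙-cancelʳ)
open import Data.List.Relation.Binary.Permutation.Setoid.Properties (≡.setoid ℕ) using (Unique-resp-↭)
open import Data.List.Relation.Unary.Unique.DecPropositional.Properties _≟_ using (deduplicate-!)
open import Data.List.Sort ≤-decTotalOrder using (sort; sort-↭; sort-↗)

dot : List ℕ → List ℕ → ℕ
dot c A = sum (zipWith _*_ c A)

RestrictedSum : (r : ℕ) (A : List ℕ) (h v : ℕ) → Set
RestrictedSum r A h v =
  ∃ λ c → All (_≤ r) c × length c ≡ length A × sum c ≡ h × dot c A ≡ v

upTo≤-bounded : ∀ r → All (_≤ r) (upTo≤ r)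
upTo≤-bounded zero    = z≤n ∷ []
upTo≤-bounded (suc r) = z≤n ∷ All.map⁺ (All.map s≤s (upTo≤-bounded r))

∈-upTo≤⁺ : ∀ {x} r → x ≤ r → x ∈ upTo≤ r
∈-upTo≤⁺ zero    z≤n       = here refl
∈-upTo≤⁺ (suc r) z≤n       = here refl
∈-upTo≤⁺ (suc r) (s≤s x≤r) = there (∈-map⁺ suc (∈-upTo≤⁺ r x≤r))

∈-coeffs⁺ : ∀ {r} c → All (_≤ r) c → c ∈ coeffs r (length c)
∈-coeffs⁺         []      []          = here refl
∈-coeffs⁺ {r} (x ∷ c) (x≤r ∷ c≤r) =
  ∈-concatMap⁺ (λ y → map (y ∷_) (coeffs r (length c)))
    (Any.map (λ { refl → ∈-map⁺ (x ∷_) (∈-coeffs⁺ c c≤r) }) (∈-upTo≤⁺ r x≤r))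

∈-coeffs⁻ : ∀ r n {c} → c ∈ coeffs r n → length c ≡ n × All (_≤ r) c
∈-coeffs⁻ r zero    (here refl) = refl , []
∈-coeffs⁻ r (suc n) c∈
  with x , x∈ , xc′∈ ← find (∈-concatMap⁻ (λ y → map (y ∷_) (coeffs r n)) {xs = upTo≤ r} c∈)
  with c′ , c′∈ , refl ← ∈-map⁻ (x ∷_) xc′∈
  with len , c′≤r ← ∈-coeffs⁻ r n c′∈
  = cong suc len , All.lookup (upTo≤-bounded r) x∈ ∷ c′≤r

∈-hSumsetList⁺ : ∀ {h r A v} → RestrictedSum r A h v → v ∈ hSumsetList h r A
∈-hSumsetList⁺ {h} {r} {A} (c , c≤r , len , refl , refl) =
  ∈-map⁺ (λ ls → dot ls A)
    (∈-filter⁺ (λ ls → sum ls ≟ h) (subst (λ n → c ∈ coeffs r n) len (∈-coeffs⁺ c c≤r)) refl)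

∈-hSumsetList⁻ : ∀ {h r A v} → v ∈ hSumsetList h r A → RestrictedSum r A h v
∈-hSumsetList⁻ {h} {r} {A} v∈
  with c , c∈ , refl ← ∈-map⁻ (λ ls → dot ls A) v∈
  with c∈′ , Σc≡h ← ∈-filter⁻ (λ ls → sum ls ≟ h) {xs = coeffs r (length A)} c∈
  with len , c≤r ← ∈-coeffs⁻ r (length A) c∈′
  = c , c≤r , len , Σc≡h , refl

∈-HSumsetList⁻ : ∀ {H r A v} → v ∈ HSumsetList H r A → ∃ λ h → h ∈ H × RestrictedSum r A h v
∈-HSumsetList⁻ {H} {r} {A} v∈
  with h , h∈H , v∈h ← find (∈-concatMap⁻ (λ h → hSumsetList h r A) {xs = H} v∈)
  = h , h∈H , ∈-hSumsetList⁻ v∈h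

dot-↭ : ∀ {B A} → B ↭ A → ∀ {c} → length c ≡ length B →
        ∃ λ c′ → c ↭ c′ × length c′ ≡ length A × dot c′ A ≡ dot c B
dot-↭ ↭.refl {c} len = c , ↭.refl , len , refl
dot-↭ (prep b B↭A) {x ∷ c} len
  with c′ , c↭c′ , len′ , dot≡ ← dot-↭ B↭A (suc-injective len)
  = x ∷ c′ , prep x c↭c′ , cong suc len′ , cong (_+_ (x * b)) dot≡
dot-↭ (swap a b B↭A) {x ∷ y ∷ c} len
  with c′ , c↭c′ , len′ , dot≡ ← dot-↭ B↭A (suc-injective (suc-injective len))
  = y ∷ x ∷ c′ , swap x y c↭c′ , cong (suc ∘ suc) len′ ,
    trans (cong (λ t → y * b + (x * a + t)) dot≡) (+-exchange (y * b) (x * a) _)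
  where
  +-exchange : ∀ m n o → m + (n + o) ≡ n + (m + o)
  +-exchange = ℕ-Solver.solve-∀
dot-↭ (↭.trans B↭C C↭A) len
  with c′ , c↭c′ , len′ , dot≡ ← dot-↭ B↭C len
  with c″ , c′↭c″ , len″ , dot≡′ ← dot-↭ C↭A len′
  = c″ , ↭.trans c↭c′ c′↭c″ , len″ , trans dot≡′ dot≡

RestrictedSum-resp-↭ : ∀ {r B A h v} → B ↭ A → RestrictedSum r B h v → RestrictedSum r A h v
RestrictedSum-resp-↭ B↭A (c , c≤r , len , refl , refl)
  with c′ , c↭c′ , len′ , dot≡ ← dot-↭ B↭A len
  = c′ , All-resp-↭ c↭c′ c≤r , len′ , sym (sum-↭ c↭c′) , dot≡

HSumsetList-↭ : ∀ {H r B A} → B ↭ A → HSumsetList H r B ⊆ HSumsetList H r A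
HSumsetList-↭ {H} {r} {B} {A} B↭A v∈ =
  ∈-concatMap⁺ (λ h → hSumsetList h r A)
    (Any.map (∈-hSumsetList⁺ ∘ RestrictedSum-resp-↭ B↭A ∘ ∈-hSumsetList⁻)
      (∈-concatMap⁻ (λ h → hSumsetList h r B) {xs = H} v∈))

remove-∈ : ∀ {A : Set} {v : A} zs → v ∈ zs →
           ∃ λ zs′ → length zs ≡ suc (length zs′) × (∀ {u} → u ∈ zs → u ≢ v → u ∈ zs′)
remove-∈ (z ∷ zs) (here refl) =
  zs , refl , λ { (here refl) u≢v → contradiction refl u≢v ; (there u∈) _ → u∈ }
remove-∈ (z ∷ zs) (there v∈)
  with zs′ , len , zs∖v ← remove-∈ zs v∈
  = z ∷ zs′ , cong suc len , λ { (here refl) _ → here refl ; (there u∈) u≢v → there (zs∖v u∈ u≢v) }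

unique⇒length-≤ : ∀ {A : Set} {xs ys : List A} → Unique xs → xs ⊆ ys → length xs ≤ length ys
unique⇒length-≤ [] _ = z≤n
unique⇒length-≤ {xs = x ∷ xs} {ys} (x∉xs ∷ xs!) xs⊆ys
  with ys′ , len , ys∖x ← remove-∈ ys (xs⊆ys (here refl))
  = subst (suc (length xs) ≤_) (sym len) (s≤s (unique⇒length-≤ xs! λ u∈xs →
      ys∖x (xs⊆ys (there u∈xs)) λ { refl → All.lookup x∉xs u∈xs refl }))

cardHSumset-≥ : ∀ {H r A vs} → Unique vs → vs ⊆ HSumsetList H r A → length vs ≤ cardHSumset H r A
cardHSumset-≥ vs! vs⊆ = unique⇒length-≤ vs! (∈-deduplicate⁺ _≟_ ∘ vs⊆)

cardHSumset-≤ : ∀ {H r A} lo T → (∀ {v} → v ∈ HSumsetList H r A → lo ≤ v × v < lo + T) →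
                cardHSumset H r A ≤ T
cardHSumset-≤ {H} {r} {A} lo T bounds =
  subst (cardHSumset H r A ≤_) (length-applyUpTo (_+_ lo) T)
    (unique⇒length-≤ (deduplicate-! (HSumsetList H r A))
      λ v∈ → ∈-interval (bounds (∈-deduplicate⁻ _≟_ (HSumsetList H r A) v∈)))
  where
  ∈-interval : ∀ {v} → lo ≤ v × v < lo + T → v ∈ applyUpTo (_+_ lo) T
  ∈-interval (lo≤v , v<lo+T) =
    subst (_∈ applyUpTo (_+_ lo) T) (m+[n∸m]≡n lo≤v)
      (∈-applyUpTo⁺ (_+_ lo) (+-cancelˡ-< lo _ _ (subst (_< lo + T) (sym (m+[n∸m]≡n lo≤v)) v<lo+T)))

-- Suffix dominance and summation by parts

infix 4 _≤ₛ_

data _≤ₛ_ : List ℕ → List ℕ → Set where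
  []  : [] ≤ₛ []
  _∷_ : ∀ {x y xs ys} → x + sum xs ≤ y + sum ys → xs ≤ₛ ys → x ∷ xs ≤ₛ y ∷ ys

-- Σᵢ i · cᵢ, positions counted from 0.
moment : List ℕ → ℕ
moment []       = 0
moment (x ∷ xs) = sum xs + moment xs

≤ₛ-refl : ∀ xs → xs ≤ₛ xs
≤ₛ-refl []       = []
≤ₛ-refl (x ∷ xs) = ≤-refl ∷ ≤ₛ-refl xs

≤ₛ-length : ∀ {xs ys} → xs ≤ₛ ys → length xs ≡ length ys
≤ₛ-length []           = refl
≤ₛ-length (_ ∷ xs≤ₛys) = cong suc (≤ₛ-length xs≤ₛys)

≤ₛ-sum : ∀ {xs ys} → xs ≤ₛ ys → sum xs ≤ sum ys
≤ₛ-sum []        = z≤n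
≤ₛ-sum (x≤y ∷ _) = x≤y

≤ₛ-moment : ∀ {xs ys} → xs ≤ₛ ys → moment xs ≤ moment ys
≤ₛ-moment []           = z≤n
≤ₛ-moment (_ ∷ xs≤ₛys) = +-mono-≤ (≤ₛ-sum xs≤ₛys) (≤ₛ-moment xs≤ₛys)

≤ₛ-++ʳ : ∀ {xs ys} zs → xs ≤ₛ ys → xs ++ zs ≤ₛ ys ++ zs
≤ₛ-++ʳ zs [] = ≤ₛ-refl zs
≤ₛ-++ʳ {x ∷ xs} {y ∷ ys} zs (x+xs≤y+ys ∷ xs≤ₛys) = (begin
  x + sum (xs ++ zs)     ≡⟨ cong (_+_ x) (sum-++ xs zs) ⟩
  x + (sum xs + sum zs)  ≡⟨ +-assoc x _ _ ⟨
  x + sum xs + sum zs    ≤⟨ +-monoˡ-≤ (sum zs) x+xs≤y+ys ⟩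
  y + sum ys + sum zs    ≡⟨ +-assoc y _ _ ⟩
  y + (sum ys + sum zs)  ≡⟨ cong (_+_ y) (sum-++ ys zs) ⟨
  y + sum (ys ++ zs)     ∎) ∷ ≤ₛ-++ʳ zs xs≤ₛys
  where open ≤-Reasoning

dot-abel : ∀ {b B P S} → Linked _≤_ (b ∷ B) → length P ≡ length B → P ≤ₛ S →
           dot P B + b * sum S ≤ dot S B + b * sum P
dot-abel {B = []}    {[]}    {[]}    _            _   []                = ≤-refl
dot-abel {b} {a ∷ B} {p ∷ P} {s ∷ S} (b≤a ∷ a∷B↗) len (p+P≤s+S ∷ P≤ₛS)
  with e , refl ← m≤n⇒∃[o]m+o≡n b≤a
  = +-cancelʳ-≤ (e * sum S + e * sum P) _ _ (begin
    p * (b + e) + dot P B + b * (s + sum S) + (e * sum S + e * sum P)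
      ≡⟨ regroupˡ b e p s (sum P) (sum S) (dot P B) ⟩
    dot P B + (b + e) * sum S + e * (p + sum P) + (p * b + b * s)
      ≤⟨ +-monoˡ-≤ _ (+-mono-≤ (dot-abel a∷B↗ (suc-injective len) P≤ₛS) (*-monoʳ-≤ e p+P≤s+S)) ⟩
    dot S B + (b + e) * sum P + e * (s + sum S) + (p * b + b * s)
      ≡⟨ regroupʳ b e p s (sum P) (sum S) (dot S B) ⟨
    s * (b + e) + dot S B + b * (p + sum P) + (e * sum S + e * sum P) ∎)
  where
  open ≤-Reasoning
  regroupˡ : ∀ b e p s P S d → p * (b + e) + d + b * (s + S) + (e * S + e * P)
                               ≡ d + (b + e) * S + e * (p + P) + (p * b + b * s)
  regroupˡ = ℕ-Solver.solve-∀
  regroupʳ : ∀ b e p s P S d → s * (b + e) + d + b * (p + P) + (e * S + e * P)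
                               ≡ d + (b + e) * P + e * (s + S) + (p * b + b * s)
  regroupʳ = ℕ-Solver.solve-∀

dot-mono-≤ₛ : ∀ {B P S} → Linked _≤_ B → length P ≡ length B → P ≤ₛ S → dot P B ≤ dot S B
dot-mono-≤ₛ {B} {P} {S} B↗ len P≤ₛS =
  subst₂ _≤_ (+-identityʳ (dot P B)) (+-identityʳ (dot S B)) (dot-abel (0≤ B↗) len P≤ₛS)
  where
  0≤ : ∀ {B} → Linked _≤_ B → Linked _≤_ (0 ∷ B)
  0≤ []        = [-]
  0≤ [-]       = z≤n ∷ [-]
  0≤ (a≤ ∷ B↗) = z≤n ∷ a≤ ∷ B↗

dot-strictMono-≤ₛ : ∀ {B P S} → Linked _<_ (0 ∷ B) → length P ≡ length B → P ≤ₛ S →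
                    sum P < sum S → dot P B < dot S B
dot-strictMono-≤ₛ {B} {P} {S} 0∷B↑ len P≤ₛS ΣP<ΣS =
  +-cancelʳ-< (sum P) (dot P B) (dot S B) (begin-strict
    dot P B + sum P     <⟨ +-monoʳ-< (dot P B) ΣP<ΣS ⟩
    dot P B + sum S     ≡⟨ cong (_+_ (dot P B)) (*-identityˡ (sum S)) ⟨
    dot P B + 1 * sum S ≤⟨ dot-abel (1≤ 0∷B↑) len P≤ₛS ⟩
    dot S B + 1 * sum P ≡⟨ cong (_+_ (dot S B)) (*-identityˡ (sum P)) ⟩
    dot S B + sum P     ∎)
  where
  open ≤-Reasoning
  1≤ : ∀ {B} → Linked _<_ (0 ∷ B) → Linked _≤_ (1 ∷ B)
  1≤ [-]          = [-]
  1≤ (0<a ∷ a∷B↑) = 0<a ∷ Linked.map <⇒≤ a∷B↑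

-- Extremal coefficient vectors

zeros : ℕ → List ℕ
zeros n = replicate n 0

topHeavy : (r z e m : ℕ) → List ℕ
topHeavy r z e m = zeros z ++ e ∷ replicate m r

bottomHeavy : (r a b z : ℕ) → List ℕ
bottomHeavy r a b z = replicate a r ++ b ∷ zeros z

replicate-+ : ∀ m n (x : ℕ) → replicate (m + n) x ≡ replicate m x ++ replicate n x
replicate-+ zero    n x = refl
replicate-+ (suc m) n x = cong (x ∷_) (replicate-+ m n x)

sum-replicate : ∀ n x → sum (replicate n x) ≡ n * x
sum-replicate zero    x = refl
sum-replicate (suc n) x = cong (_+_ x) (sum-replicate n x)

sum-zeros : ∀ n → sum (zeros n) ≡ 0
sum-zeros zero    = refl
sum-zeros (suc n) = sum-zeros n

sum-zeros++ : ∀ n xs → sum (zeros n ++ xs) ≡ sum xs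
sum-zeros++ zero    xs = refl
sum-zeros++ (suc n) xs = sum-zeros++ n xs

moment-zeros : ∀ n → moment (zeros n) ≡ 0
moment-zeros zero    = refl
moment-zeros (suc n) = cong₂ _+_ (sum-zeros n) (moment-zeros n)

sum-bounded : ∀ {r C} → All (_≤ r) C → sum C ≤ length C * r
sum-bounded []          = z≤n
sum-bounded (c≤r ∷ C≤r) = +-mono-≤ c≤r (sum-bounded C≤r)

replicate-bounded : ∀ {r} n → All (_≤ r) (replicate n r)
replicate-bounded n = All.replicate⁺ n ≤-refl

zeros-bounded : ∀ {r} n → All (_≤ r) (zeros n)
zeros-bounded n = All.replicate⁺ n z≤n

sum-topHeavy : ∀ r z e m → sum (topHeavy r z e m) ≡ e + m * r
sum-topHeavy r z e m = trans (sum-zeros++ z _) (cong (_+_ e) (sum-replicate m r))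

length-topHeavy : ∀ r z e m → length (topHeavy r z e m) ≡ z + suc m
length-topHeavy r z e m =
  trans (length-++ (zeros z)) (cong₂ _+_ (length-replicate z) (cong suc (length-replicate m)))

topHeavy-bounded : ∀ {r} z {e} m → e ≤ r → All (_≤ r) (topHeavy r z e m)
topHeavy-bounded z m e≤r = All.++⁺ (zeros-bounded z) (e≤r ∷ replicate-bounded m)

sum-bottomHeavy : ∀ r a b z → sum (bottomHeavy r a b z) ≡ a * r + b
sum-bottomHeavy r a b z = begin
  sum (replicate a r ++ b ∷ zeros z)         ≡⟨ sum-++ (replicate a r) _ ⟩
  sum (replicate a r) + (b + sum (zeros z))  ≡⟨ cong₂ (λ s t → s + (b + t)) (sum-replicate a r) (sum-zeros z) ⟩
  a * r + (b + 0)                            ≡⟨ cong (_+_ (a * r)) (+-identityʳ b) ⟩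
  a * r + b                                  ∎
  where open ≡-Reasoning

length-bottomHeavy : ∀ r a b z → length (bottomHeavy r a b z) ≡ a + suc z
length-bottomHeavy r a b z =
  trans (length-++ (replicate a r)) (cong₂ _+_ (length-replicate a) (cong suc (length-replicate z)))

bottomHeavy-bounded : ∀ {r} a {b} z → b ≤ r → All (_≤ r) (bottomHeavy r a b z)
bottomHeavy-bounded a z b≤r = All.++⁺ (replicate-bounded a) (b≤r ∷ zeros-bounded z)

sum-bottomHeavy++ : ∀ r a b z e m → sum (bottomHeavy r a b z ++ e ∷ replicate m r) ≡ a * r + b + (e + m * r)
sum-bottomHeavy++ r a b z e m =
  trans (sum-++ (bottomHeavy r a b z) _) (cong₂ _+_ (sum-bottomHeavy r a b z) (cong (_+_ e) (sum-replicate m r)))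

length-bottomHeavy++ : ∀ r a b z e m → length (bottomHeavy r a b z ++ e ∷ replicate m r) ≡ a + suc z + suc m
length-bottomHeavy++ r a b z e m =
  trans (length-++ (bottomHeavy r a b z)) (cong₂ _+_ (length-bottomHeavy r a b z) (cong suc (length-replicate m)))

zeros-≤ₛ : ∀ {ys} n → length ys ≡ n → zeros n ≤ₛ ys
zeros-≤ₛ {[]}     zero    _   = []
zeros-≤ₛ {y ∷ ys} (suc n) len =
  subst (_≤ y + sum ys) (sym (sum-zeros n)) z≤n ∷ zeros-≤ₛ n (suc-injective len)

≤ₛ-replicate : ∀ {r C} m → All (_≤ r) C → length C ≡ m → C ≤ₛ replicate m r
≤ₛ-replicate zero        []          _   = []
≤ₛ-replicate {r} (suc m) (c≤r ∷ C≤r) len =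
  +-mono-≤ c≤r (≤-trans (sum-bounded C≤r)
                (≤-reflexive (trans (cong (_* r) (suc-injective len)) (sym (sum-replicate m r)))))
  ∷ ≤ₛ-replicate m C≤r (suc-injective len)

≤ₛ-topHeavy : ∀ {r C} z e m → All (_≤ r) C → length C ≡ z + suc m →
              sum C ≤ sum (topHeavy r z e m) → C ≤ₛ topHeavy r z e m
≤ₛ-topHeavy zero    e m (_ ∷ C≤r) len ΣC≤ = ΣC≤ ∷ ≤ₛ-replicate m C≤r (suc-injective len)
≤ₛ-topHeavy {C = c ∷ C} (suc z) e m (_ ∷ C≤r) len ΣC≤ =
  ΣC≤ ∷ ≤ₛ-topHeavy z e m C≤r (suc-injective len) (≤-trans (m≤n+m (sum C) c) ΣC≤)

-- The coefficient vector of max h^{(r)}A when A is increasing.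
maxCoeffs : (k r : ℕ) .{{_ : NonZero r}} → ℕ → List ℕ
maxCoeffs k r h = topHeavy r (k ∸ suc (h / r)) (h % r) (h / r)

module _ (k r : ℕ) .{{_ : NonZero r}} where

  sum-maxCoeffs : ∀ h → sum (maxCoeffs k r h) ≡ h
  sum-maxCoeffs h = trans (sum-topHeavy r (k ∸ suc (h / r)) (h % r) (h / r)) (sym (m≡m%n+[m/n]*n h r))

  maxCoeffs-bounded : ∀ h → All (_≤ r) (maxCoeffs k r h)
  maxCoeffs-bounded h = topHeavy-bounded (k ∸ suc (h / r)) (h / r) (<⇒≤ (m%n<n h r))

  1+quotient<k : ∀ {h} → h < (k ∸ 1) * r → suc (h / r) < k
  1+quotient<k h<top = pred-cancel-< (m<n*o⇒m/o<n h<top)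

  length-maxCoeffs : ∀ {h} → h < (k ∸ 1) * r → length (maxCoeffs k r h) ≡ k
  length-maxCoeffs {h} h<top =
    trans (length-topHeavy r (k ∸ suc (h / r)) (h % r) (h / r)) (m∸n+n≡m (<⇒≤ (1+quotient<k h<top)))

quotient-< : ∀ {r e m e′ m′} → e′ + m′ * r < e + m * r → e < e′ → m′ < m
quotient-< {r} {e} {m} {e′} {m′} e′+m′r<e+mr e<e′ = ≰⇒> λ m≤m′ → <-asym e′+m′r<e+mr (begin-strict
  e + m * r   ≤⟨ +-monoʳ-≤ e (*-monoˡ-≤ r m≤m′) ⟩
  e + m′ * r  <⟨ +-monoˡ-< (m′ * r) e<e′ ⟩
  e′ + m′ * r ∎)
  where open ≤-Reasoning

+moment-++ : ∀ xs ys → + moment (xs ++ ys) ≡ + moment xs ℤ.+ + length xs ℤ.* + sum ys ℤ.+ + moment ys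
+moment-++ []       ys = refl
+moment-++ (x ∷ xs) ys = begin
  + sum (xs ++ ys) ℤ.+ + moment (xs ++ ys)
    ≡⟨ cong₂ ℤ._+_ (cong +_ (sum-++ xs ys)) (+moment-++ xs ys) ⟩
  (+ sum xs ℤ.+ + sum ys) ℤ.+ (+ moment xs ℤ.+ + length xs ℤ.* + sum ys ℤ.+ + moment ys)
    ≡⟨ regroup (+ sum xs) (+ sum ys) (+ moment xs) (+ length xs) (+ moment ys) ⟩
  (+ sum xs ℤ.+ + moment xs) ℤ.+ (+ 1 ℤ.+ + length xs) ℤ.* + sum ys ℤ.+ + moment ys ∎
  where
  open ≡-Reasoning
  regroup : ∀ S T M L N → (S ℤ.+ T) ℤ.+ (M ℤ.+ L ℤ.* T ℤ.+ N) ≡ (S ℤ.+ M) ℤ.+ (+ 1 ℤ.+ L) ℤ.* T ℤ.+ N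
  regroup = ℤ-Solver.solve-∀

+moment-zeros++ : ∀ z xs → + moment (zeros z ++ xs) ≡ + z ℤ.* + sum xs ℤ.+ + moment xs
+moment-zeros++ z xs rewrite +moment-++ (zeros z) xs | moment-zeros z | length-replicate z {0} =
  cong (ℤ._+ + moment xs) (ℤP.+-identityˡ (+ z ℤ.* + sum xs))

+sum-replicate : ∀ n x → + sum (replicate n x) ≡ + n ℤ.* + x
+sum-replicate n x = trans (cong +_ (sum-replicate n x)) (ℤP.pos-* n x)

+sum-peak : ∀ r e m → + sum (e ∷ replicate m r) ≡ + e ℤ.+ + m ℤ.* + r
+sum-peak r e m = cong (ℤ._+_ (+ e)) (+sum-replicate m r)

+moment-peak : ∀ r e m → + moment (e ∷ replicate m r) ≡ + m ℤ.* + r ℤ.+ + moment (replicate m r)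
+moment-peak r e m = cong (ℤ._+ + moment (replicate m r)) (+sum-replicate m r)

+moment-replicate-+ : ∀ m n x → + moment (replicate (m + n) x)
                      ≡ + moment (replicate m x) ℤ.+ + m ℤ.* (+ n ℤ.* + x) ℤ.+ + moment (replicate n x)
+moment-replicate-+ m n x = begin
  + moment (replicate (m + n) x)
    ≡⟨ cong (+_ ∘ moment) (replicate-+ m n x) ⟩
  + moment (replicate m x ++ replicate n x)
    ≡⟨ +moment-++ (replicate m x) (replicate n x) ⟩
  + moment (replicate m x) ℤ.+ + length (replicate m x) ℤ.* + sum (replicate n x) ℤ.+ + moment (replicate n x)
    ≡⟨ cong₂ (λ L T → + moment (replicate m x) ℤ.+ L ℤ.* T ℤ.+ + moment (replicate n x))
             (cong +_ (length-replicate m)) (+sum-replicate n x) ⟩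
  + moment (replicate m x) ℤ.+ + m ℤ.* (+ n ℤ.* + x) ℤ.+ + moment (replicate n x) ∎
  where open ≡-Reasoning

+moment-bottomHeavy : ∀ r a b z → + moment (bottomHeavy r a b z) ≡ + moment (replicate a r) ℤ.+ + a ℤ.* + b
+moment-bottomHeavy r a b z
  rewrite +moment-++ (replicate a r) (b ∷ zeros z) | length-replicate a {r}
        | sum-zeros z | moment-zeros z | +-identityʳ b = ℤP.+-identityʳ _

+moment-topHeavy : ∀ r z e m → + moment (topHeavy r z e m)
                   ≡ + z ℤ.* (+ e ℤ.+ + m ℤ.* + r) ℤ.+ (+ m ℤ.* + r ℤ.+ + moment (replicate m r))
+moment-topHeavy r z e m =
  trans (+moment-zeros++ z (e ∷ replicate m r))
        (cong₂ ℤ._+_ (cong (ℤ._*_ (+ z)) (+sum-peak r e m)) (+moment-peak r e m))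

+moment-topHeavy-+ : ∀ r z e m n → + moment (topHeavy r z e (m + n))
                     ≡ + z ℤ.* (+ e ℤ.+ + (m + n) ℤ.* + r) ℤ.+ (+ (m + n) ℤ.* + r ℤ.+
                       (+ moment (replicate m r) ℤ.+ + m ℤ.* (+ n ℤ.* + r) ℤ.+ + moment (replicate n r)))
+moment-topHeavy-+ r z e m n =
  trans (+moment-topHeavy r z e (m + n))
        (cong (λ W → + z ℤ.* (+ e ℤ.+ + (m + n) ℤ.* + r) ℤ.+ (+ (m + n) ℤ.* + r ℤ.+ W))
              (+moment-replicate-+ m n r))

+moment-bottomHeavy++ : ∀ r a b z e m → + moment (bottomHeavy r a b z ++ e ∷ replicate m r)
                ≡ + moment (replicate a r) ℤ.+ + a ℤ.* + b ℤ.+ + (a + suc z) ℤ.* (+ e ℤ.+ + m ℤ.* + r)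
                  ℤ.+ (+ m ℤ.* + r ℤ.+ + moment (replicate m r))
+moment-bottomHeavy++ r a b z e m =
  trans (+moment-++ (bottomHeavy r a b z) (e ∷ replicate m r))
        (cong₂ ℤ._+_ (cong₂ ℤ._+_ (+moment-bottomHeavy r a b z)
                                 (cong₂ ℤ._*_ (cong +_ (length-bottomHeavy r a b z)) (+sum-peak r e m)))
                     (+moment-peak r e m))

-- The i-th summand of 𝓛 in terms of mᵢ, mᵢ₋₁, εᵢ, εᵢ₋₁, with max{εᵢ, εᵢ₋₁} passed as X.
summand : (k r m mp ε εp X : ℤ) → ℤ
summand k r m mp ε εp X =
  r ℤ.* (m ℤ.- mp) ℤ.* (k ℤ.- m) ℤ.+ (ε ℤ.- εp) ℤ.* (k ℤ.- m ℤ.- + 1) ℤ.- X ℤ.* (m ℤ.- mp) ℤ.+ + 1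

summand-noBorrow : ∀ r zD a mp b εp →
  summand (+ (suc zD + suc (mp + a))) (+ r) (+ (mp + a)) (+ mp) (+ (εp + b)) (+ εp) (+ (εp + b))
    ℤ.+ + moment (bottomHeavy r a b zD ++ εp ∷ replicate mp r)
  ≡ + 1 ℤ.+ + moment (topHeavy r (suc zD) (εp + b) (mp + a))
summand-noBorrow r zD a mp b εp =
  trans (cong (ℤ._+_ L) (+moment-bottomHeavy++ r a b zD εp mp))
    (trans (identity (+ r) (+ zD) (+ a) (+ mp) (+ b) (+ εp) (+ moment (replicate a r)) (+ moment (replicate mp r)))
      (cong (ℤ._+_ (+ 1)) (sym (+moment-topHeavy-+ r (suc zD) (εp + b) mp a))))
  where
  L = summand (+ (suc zD + suc (mp + a))) (+ r) (+ (mp + a)) (+ mp) (+ (εp + b)) (+ εp) (+ (εp + b))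
  identity : ∀ R Z A Mp B Ep Wa Wmp → let M = Mp ℤ.+ A ; E = Ep ℤ.+ B ; K = (+ 1 ℤ.+ Z) ℤ.+ (+ 1 ℤ.+ M) in
    R ℤ.* (M ℤ.- Mp) ℤ.* (K ℤ.- M) ℤ.+ (E ℤ.- Ep) ℤ.* (K ℤ.- M ℤ.- + 1) ℤ.- E ℤ.* (M ℤ.- Mp) ℤ.+ + 1
    ℤ.+ (Wa ℤ.+ A ℤ.* B ℤ.+ (A ℤ.+ (+ 1 ℤ.+ Z)) ℤ.* (Ep ℤ.+ Mp ℤ.* R) ℤ.+ (Mp ℤ.* R ℤ.+ Wmp))
    ≡ + 1 ℤ.+ ((+ 1 ℤ.+ Z) ℤ.* (E ℤ.+ M ℤ.* R) ℤ.+ (M ℤ.* R ℤ.+ (Wmp ℤ.+ Mp ℤ.* (A ℤ.* R) ℤ.+ Wa)))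
  identity = ℤ-Solver.solve-∀

summand-borrow : ∀ r zD a mp ε δ u → r ≡ suc (suc ε + δ) + u →
  summand (+ (zD + suc (suc mp + a))) (+ r) (+ (suc mp + a)) (+ mp) (+ ε) (+ (suc ε + δ)) (+ (suc ε + δ))
    ℤ.+ + suc δ ℤ.* + a ℤ.+ + moment (bottomHeavy r a (suc ε + u) zD ++ suc ε + δ ∷ replicate mp r)
  ≡ + 1 ℤ.+ + moment (topHeavy r zD ε (suc mp + a))
summand-borrow r zD a mp ε δ u refl =
  trans (cong (ℤ._+_ L) (+moment-bottomHeavy++ r a (suc ε + u) zD (suc ε + δ) mp))
    (trans (identity (+ zD) (+ a) (+ mp) (+ ε) (+ δ) (+ u) (+ moment (replicate a r)) (+ moment (replicate mp r)))
      (cong (ℤ._+_ (+ 1)) (sym (trans (+moment-topHeavy-+ r zD ε (suc mp) a)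
        (cong (λ W → + zD ℤ.* (+ ε ℤ.+ + (suc mp + a) ℤ.* + r) ℤ.+ (+ (suc mp + a) ℤ.* + r ℤ.+
                       (W ℤ.+ + suc mp ℤ.* (+ a ℤ.* + r) ℤ.+ + moment (replicate a r))))
              (+moment-peak r r mp))))))
  where
  L = summand (+ (zD + suc (suc mp + a))) (+ r) (+ (suc mp + a)) (+ mp) (+ ε) (+ (suc ε + δ)) (+ (suc ε + δ))
      ℤ.+ + suc δ ℤ.* + a
  identity : ∀ Z A Mp E Δ U Wa Wmp →
    let Ep = + 1 ℤ.+ E ℤ.+ Δ ; R = + 1 ℤ.+ Ep ℤ.+ U ; M = + 1 ℤ.+ Mp ℤ.+ A ; K = Z ℤ.+ (+ 1 ℤ.+ M) in
    R ℤ.* (M ℤ.- Mp) ℤ.* (K ℤ.- M) ℤ.+ (E ℤ.- Ep) ℤ.* (K ℤ.- M ℤ.- + 1) ℤ.- Ep ℤ.* (M ℤ.- Mp) ℤ.+ + 1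
    ℤ.+ (+ 1 ℤ.+ Δ) ℤ.* A
    ℤ.+ (Wa ℤ.+ A ℤ.* (+ 1 ℤ.+ E ℤ.+ U) ℤ.+ (A ℤ.+ (+ 1 ℤ.+ Z)) ℤ.* (Ep ℤ.+ Mp ℤ.* R)
         ℤ.+ (Mp ℤ.* R ℤ.+ Wmp))
    ≡ + 1 ℤ.+ (Z ℤ.* (E ℤ.+ M ℤ.* R)
               ℤ.+ (M ℤ.* R ℤ.+ ((Mp ℤ.* R ℤ.+ Wmp) ℤ.+ (+ 1 ℤ.+ Mp) ℤ.* (A ℤ.* R) ℤ.+ Wa)))
  identity = ℤ-Solver.solve-∀

Lterm-digits : ∀ {k r} .{{_ : NonZero r}} {hp h m ε mp εp} →
               h / r ≡ m → h % r ≡ ε → hp / r ≡ mp → hp % r ≡ εp →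
               Lterm k r hp h ≡ summand (+ k) (+ r) (+ m) (+ mp) (+ ε) (+ εp) (+ ε ℤ.⊔ + εp)
Lterm-digits refl refl refl refl = refl

-- Chains of unit shifts

data Shift (r : ℕ) : List ℕ → List ℕ → Set where
  here  : ∀ {x y cs} → y < r → Shift r (suc x ∷ y ∷ cs) (x ∷ suc y ∷ cs)
  there : ∀ {x cs cs′} → Shift r cs cs′ → Shift r (x ∷ cs) (x ∷ cs′)

module _ {r : ℕ} where

  Shift-sum : ∀ {C C′} → Shift r C C′ → sum C′ ≡ sum C
  Shift-sum (here {x} {y} {cs} _) = +-suc x (y + sum cs)
  Shift-sum (there {x} C→C′)      = cong (_+_ x) (Shift-sum C→C′)

  Shift-length : ∀ {C C′} → Shift r C C′ → length C′ ≡ length C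
  Shift-length (here _)      = refl
  Shift-length (there C→C′)  = cong suc (Shift-length C→C′)

  Shift-moment : ∀ {C C′} → Shift r C C′ → moment C′ ≡ suc (moment C)
  Shift-moment (here _)                  = refl
  Shift-moment (there {cs = C} C→C′) =
    trans (cong₂ _+_ (Shift-sum C→C′) (Shift-moment C→C′)) (+-suc (sum C) (moment C))

  Shift-bounded : ∀ {C C′} → Shift r C C′ → All (_≤ r) C → All (_≤ r) C′
  Shift-bounded (here y<r)    (x+1≤r ∷ _ ∷ cs≤r) = <⇒≤ x+1≤r ∷ y<r ∷ cs≤r
  Shift-bounded (there C→C′)  (x≤r ∷ C≤r)        = x≤r ∷ Shift-bounded C→C′ C≤r

  Shift-dot : ∀ {B C C′} → Linked _<_ B → length C ≡ length B → Shift r C C′ → dot C B < dot C′ B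
  Shift-dot {a ∷ b ∷ B} (a<b ∷ _) _ (here {x} {y} {cs} _) =
    subst₂ _<_ (regroup x y a b (dot cs B)) (regroup′ x y a b (dot cs B))
      (+-monoʳ-< (x * a + y * b + dot cs B) a<b)
    where
    regroup : ∀ x y a b d → x * a + y * b + d + a ≡ suc x * a + (y * b + d)
    regroup = ℕ-Solver.solve-∀
    regroup′ : ∀ x y a b d → x * a + y * b + d + b ≡ x * a + (suc y * b + d)
    regroup′ = ℕ-Solver.solve-∀
  Shift-dot {[]} _ () (here _)
  Shift-dot {[]} _ () (there _)
  Shift-dot {a ∷ B} B↑ len (there {x} C→C′) =
    +-monoʳ-< (x * a) (Shift-dot (Linked.tail B↑) (suc-injective len) C→C′)

  module _ .{{_ : NonZero r}} where

    -- The unit enters C at its first entry if that is below r; otherwise that entry is full, so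
    -- the rest of C is still short of D and one of its units moves on instead.
    shift-into : ∀ x {C D} → C ≤ₛ D → sum C < sum D → All (_≤ r) C → All (_≤ r) D →
                 ∃ λ z → ∃ λ C′ → Shift r (suc x ∷ C) (z ∷ C′) × C′ ≤ₛ D
    shift-into x {y ∷ C} {d ∷ D} (_ ∷ C≤ₛD) y+C<d+D (y≤r ∷ C≤r) (d≤r ∷ D≤r) with y <? r
    ... | yes y<r = x , suc y ∷ C , here y<r , y+C<d+D ∷ C≤ₛD
    ... | no y≮r
      with y′ , refl ← m≤n⇒∃[o]m+o≡n (>-nonZero⁻¹ r)
      with refl ← ≤-antisym y≤r (≮⇒≥ y≮r)
      = let z , C′ , C→C′ , C′≤ₛD = shift-into y′ C≤ₛD ΣC<ΣD C≤r D≤r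
        in suc x , z ∷ C′ , there C→C′ , subst (_≤ d + sum D) (sym (Shift-sum C→C′)) (<⇒≤ y+C<d+D) ∷ C′≤ₛD
      where
      ΣC<ΣD : sum C < sum D
      ΣC<ΣD = +-cancelˡ-< (suc y′) _ _ (<-≤-trans y+C<d+D (+-monoˡ-≤ (sum D) d≤r))

    shift-toward : ∀ {C D} → C ≤ₛ D → sum C ≡ sum D → moment C < moment D →
                   All (_≤ r) C → All (_≤ r) D → ∃ λ C′ → Shift r C C′ × C′ ≤ₛ D
    shift-toward {c ∷ C} {d ∷ D} (c+C≤d+D ∷ C≤ₛD) c+C≡d+D C<D (_ ∷ C≤r) (_ ∷ D≤r)
      with m≤n⇒m<n∨m≡n (≤ₛ-sum C≤ₛD)
    ... | inj₂ ΣC≡ΣD =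
      let C′ , C→C′ , C′≤ₛD = shift-toward C≤ₛD ΣC≡ΣD momentC<momentD C≤r D≤r
      in c ∷ C′ , there C→C′ , subst (_≤ d + sum D) (cong (_+_ c) (sym (Shift-sum C→C′))) c+C≤d+D ∷ C′≤ₛD
      where
      momentC<momentD : moment C < moment D
      momentC<momentD = +-cancelˡ-< (sum C) _ _ (subst (λ t → sum C + moment C < t + moment D) (sym ΣC≡ΣD) C<D)
    ... | inj₁ ΣC<ΣD with c
    ...   | zero = contradiction c+C≡d+D (<⇒≢ (<-≤-trans ΣC<ΣD (m≤n+m (sum D) d)))
    ...   | suc x
      with z , C′ , C→C′ , C′≤ₛD ← shift-into x C≤ₛD ΣC<ΣD C≤r D≤r
      = z ∷ C′ , C→C′ , subst (_≤ d + sum D) (sym (Shift-sum C→C′)) c+C≤d+D ∷ C′≤ₛD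

    module _ {B : List ℕ} (0∷B↑ : Linked _<_ (0 ∷ B)) where

      B↑ : Linked _<_ B
      B↑ = Linked.tail 0∷B↑

      shiftChain : ∀ n {C D} → moment D ≡ n + moment C → C ≤ₛ D → sum C ≡ sum D →
                   All (_≤ r) C → All (_≤ r) D → length C ≡ length B →
                   ∃ λ vs → Unique vs × length vs ≡ suc n ×
                     All (λ v → dot C B ≤ v × v ≤ dot D B × RestrictedSum r B (sum D) v) vs
      shiftChain zero {C} {D} _ C≤ₛD ΣC≡ΣD C≤r _ len =
        dot C B ∷ [] , [] ∷ [] , refl ,
        (≤-refl , dot-mono-≤ₛ (Linked.map <⇒≤ B↑) len C≤ₛD , (C , C≤r , len , ΣC≡ΣD , refl)) ∷ []
      shiftChain (suc n) {C} {D} D≡n+1+C C≤ₛD ΣC≡ΣD C≤r D≤r len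
        with C′ , C→C′ , C′≤ₛD ←
               shift-toward C≤ₛD ΣC≡ΣD (subst (moment C <_) (sym D≡n+1+C) (m<n+m (moment C) z<s)) C≤r D≤r
        with vs , vs! , vs-len , vs∈ ← shiftChain n
               (trans D≡n+1+C (trans (sym (+-suc n (moment C))) (cong (_+_ n) (sym (Shift-moment C→C′)))))
               C′≤ₛD (trans (Shift-sum C→C′) ΣC≡ΣD) (Shift-bounded C→C′ C≤r) D≤r (trans (Shift-length C→C′) len)
        = dot C B ∷ vs ,
          All.map (λ (C′≤v , _) → <⇒≢ (<-≤-trans C<C′ C′≤v)) vs∈ ∷ vs! ,
          cong suc vs-len ,
          (≤-refl , dot-mono-≤ₛ (Linked.map <⇒≤ B↑) len C≤ₛD , (C , C≤r , len , ΣC≡ΣD , refl)) ∷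
          All.map (λ (C′≤v , rest) → <⇒≤ (<-≤-trans C<C′ C′≤v) , rest) vs∈
        where
        C<C′ : dot C B < dot C′ B
        C<C′ = Shift-dot B↑ len C→C′

      SumBetween : (lo hi h v : ℕ) → Set
      SumBetween lo hi h v = lo < v × v ≤ hi × RestrictedSum r B h v

      valuesBetween : ∀ {P S D} → P ≤ₛ S → sum P < sum S → S ≤ₛ D → sum S ≡ sum D →
                      All (_≤ r) S → All (_≤ r) D → length S ≡ length B →
                      ∃ λ vs → Unique vs × length vs + moment S ≡ suc (moment D) ×
                        All (SumBetween (dot P B) (dot D B) (sum D)) vs
      valuesBetween {P} {S} {D} P≤ₛS ΣP<ΣS S≤ₛD ΣS≡ΣD S≤r D≤r len
        with vs , vs! , vs-len , vs∈ ←
               shiftChain (moment D ∸ moment S) (sym (m∸n+n≡m (≤ₛ-moment S≤ₛD))) S≤ₛD ΣS≡ΣD S≤r D≤r len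
        = vs , vs! ,
          trans (cong (_+ moment S) vs-len) (cong suc (m∸n+n≡m (≤ₛ-moment S≤ₛD))) ,
          All.map (λ (S≤v , rest) → <-≤-trans P<S S≤v , rest) vs∈
        where
        P<S : dot P B < dot S B
        P<S = dot-strictMono-≤ₛ 0∷B↑ (trans (≤ₛ-length P≤ₛS) len) P≤ₛS ΣP<ΣS

      valuesAbove : ∀ {zP mp εp zD m ε} a b z → b ≤ r → εp ≤ r → ε ≤ r →
                    length B ≡ zD + suc m → zP + suc mp ≡ zD + suc m → a + suc z + suc mp ≡ zD + suc m →
                    a * r + b + (εp + mp * r) ≡ ε + m * r → εp + mp * r < ε + m * r →
                    ∃ λ vs → Unique vs ×
                      length vs + moment (bottomHeavy r a b z ++ εp ∷ replicate mp r)
                        ≡ suc (moment (topHeavy r zD ε m)) ×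
                      All (SumBetween (dot (topHeavy r zP εp mp) B) (dot (topHeavy r zD ε m) B) (sum (topHeavy r zD ε m))) vs
      valuesAbove {zP} {mp} {εp} {zD} {m} {ε} a b z b≤r εp≤r ε≤r lenB lenP lenS ΣS≡h hp<h =
        valuesBetween P≤ₛS ΣP<ΣS S≤ₛD ΣS≡ΣD S≤r (topHeavy-bounded zD m ε≤r)
          (trans (length-bottomHeavy++ r a b z εp mp) (trans lenS (sym lenB)))
        where
        S = bottomHeavy r a b z ++ εp ∷ replicate mp r
        P≤ₛS : topHeavy r zP εp mp ≤ₛ S
        P≤ₛS = ≤ₛ-++ʳ (εp ∷ replicate mp r)
                 (zeros-≤ₛ zP (trans (length-bottomHeavy r a b z) (+-cancelʳ-≡ (suc mp) _ _ (trans lenS (sym lenP)))))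
        ΣS≡ΣD : sum S ≡ sum (topHeavy r zD ε m)
        ΣS≡ΣD = trans (sum-bottomHeavy++ r a b z εp mp) (trans ΣS≡h (sym (sum-topHeavy r zD ε m)))
        ΣP<ΣS : sum (topHeavy r zP εp mp) < sum S
        ΣP<ΣS = subst₂ _<_ (sym (sum-topHeavy r zP εp mp))
                  (trans (sym ΣS≡h) (sym (sum-bottomHeavy++ r a b z εp mp))) hp<h
        S≤r : All (_≤ r) S
        S≤r = All.++⁺ (bottomHeavy-bounded a z b≤r) (εp≤r ∷ replicate-bounded mp)
        S≤ₛD : S ≤ₛ topHeavy r zD ε m
        S≤ₛD = ≤ₛ-topHeavy zD ε m S≤r (trans (length-bottomHeavy++ r a b z εp mp) lenS) (≤-reflexive ΣS≡ΣD)

      block-noBorrow : ∀ {zP} zD a mp b εp → εp + b < r →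
                       length B ≡ suc zD + suc (mp + a) → zP + suc mp ≡ suc zD + suc (mp + a) →
                       εp + mp * r < εp + b + (mp + a) * r →
                       ∃ λ vs → Unique vs ×
                         summand (+ (suc zD + suc (mp + a))) (+ r) (+ (mp + a)) (+ mp) (+ (εp + b)) (+ εp) (+ (εp + b))
                           ≡ + length vs ×
                         All (SumBetween (dot (topHeavy r zP εp mp) B) (dot (topHeavy r (suc zD) (εp + b) (mp + a)) B)
                                         (sum (topHeavy r (suc zD) (εp + b) (mp + a)))) vs
      block-noBorrow zD a mp b εp ε<r lenB lenP hp<h =
        let vs , vs! , count , vs∈ =
              valuesAbove {zD = suc zD} {m = mp + a} a b zD
                (≤-trans (m≤n+m b εp) (<⇒≤ ε<r)) (≤-trans (m≤m+n εp b) (<⇒≤ ε<r)) (<⇒≤ ε<r)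
                lenB lenP (lengths a zD mp) (sums r a b εp mp) hp<h
        in vs , vs! , ∙-cancelʳ (+ moment (bottomHeavy r a b zD ++ εp ∷ replicate mp r)) _ _
                        (trans (summand-noBorrow r zD a mp b εp) (cong +_ (sym count))) , vs∈
        where
        lengths : ∀ a zD mp → a + suc zD + suc mp ≡ suc zD + suc (mp + a)
        lengths = ℕ-Solver.solve-∀
        sums : ∀ r a b εp mp → a * r + b + (εp + mp * r) ≡ εp + b + (mp + a) * r
        sums = ℕ-Solver.solve-∀

      block-borrow : ∀ {zP} zD a mp ε δ u → r ≡ suc (suc ε + δ) + u →
                     length B ≡ zD + suc (suc mp + a) → zP + suc mp ≡ zD + suc (suc mp + a) →
                     suc ε + δ + mp * r < ε + (suc mp + a) * r →
                     ∃ λ vs → Unique vs ×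
                       summand (+ (zD + suc (suc mp + a))) (+ r) (+ (suc mp + a)) (+ mp) (+ ε) (+ (suc ε + δ)) (+ (suc ε + δ))
                         ℤ.≤ + length vs ×
                       All (SumBetween (dot (topHeavy r zP (suc ε + δ) mp) B) (dot (topHeavy r zD ε (suc mp + a)) B)
                                       (sum (topHeavy r zD ε (suc mp + a)))) vs
      block-borrow zD a mp ε δ u r≡ lenB lenP hp<h =
        let vs , vs! , count , vs∈ =
              valuesAbove {zD = zD} {m = suc mp + a} a (suc ε + u) zD
                b≤r (<⇒≤ εp<r) (≤-trans (≤-trans (n≤1+n ε) (m≤m+n (suc ε) δ)) (<⇒≤ εp<r))
                lenB lenP (lengths a zD mp) (sums r r≡) hp<h
        in vs , vs! ,
           ℤP.≤-trans (subst (λ j → L ℤ.≤ L ℤ.+ j) (ℤP.pos-* (suc δ) a) (ℤP.i≤i+j L (+ (suc δ * a))))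
             (ℤP.≤-reflexive (∙-cancelʳ (+ moment (bottomHeavy r a (suc ε + u) zD ++ suc ε + δ ∷ replicate mp r)) _ _
               (trans (summand-borrow r zD a mp ε δ u r≡) (cong +_ (sym count))))) ,
           vs∈
        where
        L = summand (+ (zD + suc (suc mp + a))) (+ r) (+ (suc mp + a)) (+ mp) (+ ε) (+ (suc ε + δ)) (+ (suc ε + δ))
        εp<r : suc ε + δ < r
        εp<r = subst (suc ε + δ <_) (sym r≡) (m≤m+n (suc (suc ε + δ)) u)
        b≤r : suc ε + u ≤ r
        b≤r = subst (suc ε + u ≤_) (sym r≡) (+-monoˡ-≤ u (≤-trans (m≤m+n (suc ε) δ) (n≤1+n _)))
        lengths : ∀ a zD mp → a + suc zD + suc mp ≡ zD + suc (suc mp + a)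
        lengths = ℕ-Solver.solve-∀
        sums : ∀ r → r ≡ suc (suc ε + δ) + u → a * r + (suc ε + u) + (suc ε + δ + mp * r) ≡ ε + (suc mp + a) * r
        sums _ refl = identity ε δ u a mp
          where
          identity : ∀ ε δ u a mp → let r = suc (suc ε + δ) + u in
                     a * r + (suc ε + u) + (suc ε + δ + mp * r) ≡ ε + (suc mp + a) * r
          identity = ℕ-Solver.solve-∀

      block-digits : ∀ {zP mp εp zD m ε} → length B ≡ zD + suc m → zP + suc mp ≡ zD + suc m → 0 < zD →
                    εp < r → ε < r → mp ≤ m → εp + mp * r < ε + m * r →
                    ∃ λ vs → Unique vs ×
                      summand (+ (zD + suc m)) (+ r) (+ m) (+ mp) (+ ε) (+ εp) (+ ε ℤ.⊔ + εp) ℤ.≤ + length vs ×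
                      All (SumBetween (dot (topHeavy r zP εp mp) B) (dot (topHeavy r zD ε m) B) (sum (topHeavy r zD ε m))) vs
      block-digits {zP} {mp} {εp} {suc zD} {m} {ε} lenB lenP _ εp<r ε<r mp≤m hp<h with εp ≤? ε
      ... | yes εp≤ε
        with a , refl ← m≤n⇒∃[o]m+o≡n mp≤m
        with b , refl ← m≤n⇒∃[o]m+o≡n εp≤ε
        = let vs , vs! , count , vs∈ = block-noBorrow zD a mp b εp ε<r lenB lenP hp<h in
          vs , vs! ,
          ℤP.≤-reflexive (trans (cong (summand (+ (suc zD + suc (mp + a))) (+ r) (+ (mp + a)) (+ mp) (+ (εp + b)) (+ εp))
                                      (ℤP.i≥j⇒i⊔j≡i (ℤ.+≤+ (m≤m+n εp b))))
                                count) ,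
          vs∈
      ... | no εp≰ε
        with a , refl ← m≤n⇒∃[o]m+o≡n (quotient-< {r} {ε} {m} {εp} {mp} hp<h (≰⇒> εp≰ε))
        with δ , refl ← m≤n⇒∃[o]m+o≡n (≰⇒> εp≰ε)
        with u , r≡ ← m≤n⇒∃[o]m+o≡n εp<r
        = let vs , vs! , count , vs∈ = block-borrow (suc zD) a mp ε δ u (sym r≡) lenB lenP hp<h in
          vs , vs! ,
          subst (λ X → summand (+ (suc zD + suc (suc mp + a))) (+ r) (+ (suc mp + a)) (+ mp) (+ ε) (+ (suc ε + δ)) X
                         ℤ.≤ + length vs)
                (sym (ℤP.i≤j⇒i⊔j≡j (ℤ.+≤+ (<⇒≤ (≰⇒> εp≰ε))))) count ,
          vs∈

      block : ∀ {k hp h} → length B ≡ k → hp < h → h < (k ∸ 1) * r →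
              ∃ λ vs → Unique vs × Lterm k r hp h ℤ.≤ + length vs ×
                All (SumBetween (dot (maxCoeffs k r hp) B) (dot (maxCoeffs k r h) B) h) vs
      block {k} {hp} {h} lenB hp<h h<top =
        let vs , vs! , count , vs∈ =
              block-digits (trans lenB (sym kD)) (trans kP (sym kD)) (m<n⇒0<n∸m m+1<k)
                (m%n<n hp r) (m%n<n h r) mp≤m (subst₂ _<_ (m≡m%n+[m/n]*n hp r) (m≡m%n+[m/n]*n h r) hp<h)
        in vs , vs! ,
           subst (λ K → summand (+ K) (+ r) (+ (h / r)) (+ (hp / r)) (+ (h % r)) (+ (hp % r)) (+ (h % r) ℤ.⊔ + (hp % r))
                          ℤ.≤ + length vs) kD count ,
           All.map (λ (lo , hi , v∈) → lo , hi , subst (λ h → RestrictedSum r B h _) (sum-maxCoeffs k r h) v∈) vs∈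
        where
        mp≤m : hp / r ≤ h / r
        mp≤m = /-monoˡ-≤ r (<⇒≤ hp<h)
        m+1<k : suc (h / r) < k
        m+1<k = 1+quotient<k k r h<top
        kD : k ∸ suc (h / r) + suc (h / r) ≡ k
        kD = m∸n+n≡m (<⇒≤ m+1<k)
        kP : k ∸ suc (hp / r) + suc (hp / r) ≡ k
        kP = m∸n+n≡m (≤-trans (s≤s mp≤m) (<⇒≤ m+1<k))

      maxCoeffs-dot-< : ∀ {k hp h} → length B ≡ k → hp < h → h < (k ∸ 1) * r →
                        dot (maxCoeffs k r hp) B < dot (maxCoeffs k r h) B
      maxCoeffs-dot-< {k} {hp} {h} lenB hp<h h<top =
        dot-strictMono-≤ₛ 0∷B↑ (trans (length-maxCoeffs k r hp<top) (sym lenB))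
          (≤ₛ-topHeavy (k ∸ suc (h / r)) (h % r) (h / r) (maxCoeffs-bounded k r hp)
             (trans (length-maxCoeffs k r hp<top)
                    (trans (sym (length-maxCoeffs k r h<top)) (length-topHeavy r (k ∸ suc (h / r)) (h % r) (h / r))))
             (subst₂ _≤_ (sym (sum-maxCoeffs k r hp)) (sym (sum-maxCoeffs k r h)) (<⇒≤ hp<h)))
          (subst₂ _<_ (sym (sum-maxCoeffs k r hp)) (sym (sum-maxCoeffs k r h)) hp<h)
        where
        hp<top : hp < (k ∸ 1) * r
        hp<top = <-trans hp<h h<top

      blocks : ∀ {k} → length B ≡ k → ∀ prev H → Linked _<_ (prev ∷ H) → All (_< (k ∸ 1) * r) H →
               ∃ λ vs → Unique vs × Lgo k r prev H ℤ.≤ + length vs ×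
                 All (λ v → dot (maxCoeffs k r prev) B < v × v ∈ HSumsetList H r B) vs
      blocks lenB prev []      _              _              = [] , [] , ℤP.≤-refl , []
      blocks {k} lenB prev (h ∷ H) (prev<h ∷ h∷H↑) (h<top ∷ H<top) =
        let vs , vs! , vs-count , vs∈ = block lenB prev<h h<top
            ws , ws! , ws-count , ws∈ = blocks lenB h H h∷H↑ H<top
        in vs ++ ws ,
           Unique.++⁺ vs! ws! (λ (v∈vs , v∈ws) → <-irrefl refl
             (≤-<-trans (proj₁ (proj₂ (All.lookup vs∈ v∈vs))) (proj₁ (All.lookup ws∈ v∈ws)))) ,
           subst (λ n → Lgo k r prev (h ∷ H) ℤ.≤ + n) (sym (length-++ vs)) (ℤP.+-mono-≤ vs-count ws-count) ,
           All.++⁺ (All.map (λ (lo , _ , v∈) → lo , ∈-++⁺ˡ (∈-hSumsetList⁺ v∈)) vs∈)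
                   (All.map (λ (lo , v∈) → <-trans (maxCoeffs-dot-< lenB prev<h h<top) lo , ∈-++⁺ʳ _ v∈) ws∈)

0∷-increasing : ∀ {xs} → Linked _≤_ xs → Unique xs → All (1 ≤_) xs → Linked _<_ (0 ∷ xs)
0∷-increasing []           []               []          = [-]
0∷-increasing [-]          _                (1≤x ∷ [])  = 1≤x ∷ [-]
0∷-increasing (x≤y ∷ xs↗) ((x≢y ∷ _) ∷ xs!) (1≤x ∷ xs⁺) =
  1≤x ∷ ≤∧≢⇒< x≤y x≢y ∷ Linked.tail (0∷-increasing xs↗ xs! xs⁺)

lowerBound : ∀ {k r} .{{_ : NonZero r}} {A H} → Unique A → length A ≡ k → All (1 ≤_) A →
             Linked _<_ (0 ∷ H) → All (_< (k ∸ 1) * r) H → 𝓛 k H r ℤ.≤ + cardHSumset H r A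
lowerBound {k} {r} {A} {H} A! lenA A⁺ 0∷H↑ H<top =
  let vs , vs! , count , vs∈ = blocks {r = r} 0∷B↑ (trans (↭-length (sort-↭ A)) lenA) 0 H 0∷H↑ H<top
  in ℤP.≤-trans count (ℤ.+≤+ (cardHSumset-≥ {H} {r} {A} vs! λ v∈vs →
       HSumsetList-↭ {H} {r} (sort-↭ A) (proj₂ (All.lookup vs∈ v∈vs))))
  where
  A↭B : A ↭ sort A
  A↭B = ↭.↭-sym (sort-↭ A)
  0∷B↑ : Linked _<_ (0 ∷ sort A)
  0∷B↑ = 0∷-increasing (sort-↗ A) (Unique-resp-↭ (↭.↭⇒↭ₛ A↭B) A!) (All-resp-↭ A↭B A⁺)

≤pred⇒< : ∀ {m n} → 0 < m → m ≤ pred n → m < n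
≤pred⇒< {n = zero}  0<m m≤0 = contradiction (<-≤-trans 0<m m≤0) (<-irrefl refl)
≤pred⇒< {n = suc n} _   m≤n = s≤s m≤n

≤-maxList : ∀ H → All (_≤ maxList H) H
≤-maxList []      = []
≤-maxList (h ∷ H) =
  m≤m⊔n h (maxList H) ∷ All.map (λ h′≤ → ≤-trans h′≤ (m≤n⊔m h (maxList H))) (≤-maxList H)

ValidH⇒below : ∀ {k r H} → ValidH k r H → All (_< (k ∸ 1) * r) H
ValidH⇒below {H = H} (_ , _ , H⁺ , _ , max≤) =
  All.zipWith (λ (1≤h , h≤max) → ≤pred⇒< 1≤h (≤-trans h≤max max≤)) (H⁺ , ≤-maxList H)

ValidH⇒0∷increasing : ∀ {k r H} → ValidH k r H → Linked _<_ (0 ∷ H)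
ValidH⇒0∷increasing {H = []}    _                     = [-]
ValidH⇒0∷increasing {H = _ ∷ _} (H↑ , _ , 1≤h ∷ _ , _) = 1≤h ∷ H↑

-- The extremal example

𝓛-extremal : ∀ k′ r .{{_ : NonZero r}} → 𝓛 (suc k′) (r ∷ suc r ∷ []) r ≡ + (k′ * r + suc k′)
-- For r = 1 the quotient and remainder of r + 1 are 2 and 0 rather than 1 and 1.
𝓛-extremal k′ 1 = trans (identity (+ k′)) (cong (ℤ._+ + suc k′) (sym (ℤP.pos-* k′ 1)))
  where
  identity : ∀ K → let K+1 = + 1 ℤ.+ K in
    + 1 ℤ.* (+ 1 ℤ.- + 0) ℤ.* (K+1 ℤ.- + 1) ℤ.+ (+ 0 ℤ.- + 0) ℤ.* (K+1 ℤ.- + 1 ℤ.- + 1) ℤ.- + 0 ℤ.* (+ 1 ℤ.- + 0) ℤ.+ + 1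
    ℤ.+ (+ 1 ℤ.* (+ 2 ℤ.- + 1) ℤ.* (K+1 ℤ.- + 2) ℤ.+ (+ 0 ℤ.- + 0) ℤ.* (K+1 ℤ.- + 2 ℤ.- + 1) ℤ.- + 0 ℤ.* (+ 2 ℤ.- + 1) ℤ.+ + 1
         ℤ.+ + 0)
    ≡ K ℤ.* + 1 ℤ.+ K+1
  identity = ℤ-Solver.solve-∀
𝓛-extremal k′ r@(suc (suc _)) =
  trans (cong₂ ℤ._+_ (Lterm-digits {suc k′} {r} {0} {r} (n/n≡1 r) (n%n≡0 r) refl refl)
                     (cong (ℤ._+ + 0) (Lterm-digits {suc k′} {r} {r} {suc r}
                                         [1+r]/r≡1 ([m+n]%n≡m%n 1 r) (n/n≡1 r) (n%n≡0 r))))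
        (trans (identity (+ k′) (+ r)) (cong (ℤ._+ + suc k′) (sym (ℤP.pos-* k′ r))))
  where
  [1+r]/r≡1 : suc r / r ≡ 1
  [1+r]/r≡1 = trans (m/n≡1+[m∸n]/n (n≤1+n r)) (cong (λ t → 1 + t / r) (m+n∸n≡m 1 r))
  identity : ∀ K R → let K+1 = + 1 ℤ.+ K in
    R ℤ.* (+ 1 ℤ.- + 0) ℤ.* (K+1 ℤ.- + 1) ℤ.+ (+ 0 ℤ.- + 0) ℤ.* (K+1 ℤ.- + 1 ℤ.- + 1) ℤ.- + 0 ℤ.* (+ 1 ℤ.- + 0) ℤ.+ + 1
    ℤ.+ (R ℤ.* (+ 1 ℤ.- + 1) ℤ.* (K+1 ℤ.- + 1) ℤ.+ (+ 1 ℤ.- + 0) ℤ.* (K+1 ℤ.- + 1 ℤ.- + 1) ℤ.- + 1 ℤ.* (+ 1 ℤ.- + 1) ℤ.+ + 1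
         ℤ.+ + 0)
    ≡ K ℤ.* R ℤ.+ K+1
  identity = ℤ-Solver.solve-∀

descending : ℕ → List ℕ
descending n = map suc (downFrom n)

descending-valid : ∀ n → ValidA n (descending n)
descending-valid n =
  Unique.map⁺ suc-injective (Unique.downFrom⁺ n) ,
  trans (length-map suc (downFrom n)) (length-downFrom n) ,
  All.map⁺ (All.universal (λ _ → s≤s z≤n) (downFrom n))

sum≤dot : ∀ {c A} → All (1 ≤_) A → length c ≡ length A → sum c ≤ dot c A
sum≤dot {[]}    {[]}    []          _   = z≤n
sum≤dot {x ∷ c} {a ∷ A} (1≤a ∷ A⁺) len =
  +-mono-≤ (subst (_≤ x * a) (*-identityʳ x) (*-monoʳ-≤ x 1≤a)) (sum≤dot {c} A⁺ (suc-injective len))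

dot-descending : ∀ n c → dot c (descending n) ≤ n * sum c
dot-descending zero    []      = z≤n
dot-descending zero    (_ ∷ _) = z≤n
dot-descending (suc n) []      = z≤n
dot-descending (suc n) (x ∷ c) = begin
  x * suc n + dot c (descending n)  ≤⟨ +-monoʳ-≤ (x * suc n) (dot-descending n c) ⟩
  x * suc n + n * sum c             ≤⟨ +-monoʳ-≤ (x * suc n) (*-monoˡ-≤ (sum c) (n≤1+n n)) ⟩
  x * suc n + suc n * sum c         ≡⟨ identity x n (sum c) ⟩
  suc n * (x + sum c)               ∎
  where
  open ≤-Reasoning
  identity : ∀ x n s → x * suc n + suc n * s ≡ suc n * (x + s)
  identity = ℕ-Solver.solve-∀

dot-descending-∷ : ∀ n x c → dot (x ∷ c) (descending (suc n)) + sum c ≤ suc n * (x + sum c)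
dot-descending-∷ n x c = begin
  x * suc n + dot c (descending n) + sum c  ≤⟨ +-monoˡ-≤ (sum c) (+-monoʳ-≤ (x * suc n) (dot-descending n c)) ⟩
  x * suc n + n * sum c + sum c             ≡⟨ identity x n (sum c) ⟩
  suc n * (x + sum c)                       ∎
  where
  open ≤-Reasoning
  identity : ∀ x n s → x * suc n + n * s + s ≡ suc n * (x + s)
  identity = ℕ-Solver.solve-∀

-- Either all of h sits on the top element k, so h ≤ r, or some unit sits lower and costs at least 1.
descending-sum-< : ∀ {n r h v} → RestrictedSum r (descending (suc n)) h v → h ≤ suc r → v < suc n * suc r
descending-sum-< {n} {r} (x ∷ c , x≤r ∷ _ , _ , refl , refl) h≤1+r
  with sum c | dot-descending-∷ n x c | h≤1+r
... | zero  | v+0≤ | _ = begin-strict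
  dot (x ∷ c) (descending (suc n))  ≤⟨ m+n≤o⇒m≤o _ v+0≤ ⟩
  suc n * (x + 0)                   ≡⟨ cong (_*_ (suc n)) (+-identityʳ x) ⟩
  suc n * x                         <⟨ *-monoʳ-< (suc n) (s≤s x≤r) ⟩
  suc n * suc r                     ∎
  where open ≤-Reasoning
... | suc s | v+s+1≤ | x+s+1≤1+r = begin-strict
  dot (x ∷ c) (descending (suc n))  <⟨ m<m+n _ z<s ⟩
  dot (x ∷ c) (descending (suc n)) + suc s  ≤⟨ v+s+1≤ ⟩
  suc n * (x + suc s)               ≤⟨ *-monoʳ-≤ (suc n) x+s+1≤1+r ⟩
  suc n * suc r                     ∎
  where open ≤-Reasoning

-- The existence of a valid H matters only for r = 1, where it rules out k = 3.
2+r≤k′r : ∀ {k′ r H} .{{_ : NonZero r}} → 2 ≤ k′ → ValidH (suc k′) r H → 2 + r ≤ k′ * r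
2+r≤k′r {r = 1} {[]}     _ (_ , () , _)
2+r≤k′r {r = 1} {_ ∷ []} _ (_ , s≤s () , _)
2+r≤k′r {k′} {1} {h₁ ∷ h₂ ∷ H} _ (h₁<h₂ ∷ _ , _ , 1≤h₁ ∷ _ , _ , max≤) =
  ≤pred⇒< z<s (≤-trans (<-≤-trans (s≤s 1≤h₁) h₁<h₂)
                       (≤-trans (All.head (All.tail (≤-maxList (h₁ ∷ h₂ ∷ H)))) max≤))
2+r≤k′r {k′} {r@(suc (suc _))} 2≤k′ _ = begin
  2 + r   ≤⟨ +-monoˡ-≤ r (s≤s (s≤s z≤n)) ⟩
  r + r   ≡⟨ cong (_+_ r) (+-identityʳ r) ⟨
  2 * r   ≤⟨ *-monoˡ-≤ r 2≤k′ ⟩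
  k′ * r  ∎
  where open ≤-Reasoning

extremal : ∀ {k′ r} .{{_ : NonZero r}} → 2 + r ≤ k′ * r →
           ValidA (suc k′) (descending (suc k′)) × ValidH (suc k′) r (r ∷ suc r ∷ []) ×
           𝓛 (suc k′) (r ∷ suc r ∷ []) r ≡ + cardHSumset (r ∷ suc r ∷ []) r (descending (suc k′))
extremal {k′} {r} 2+r≤k′r = A-valid , H-valid , ℤP.≤-antisym lower upper
  where
  H = r ∷ suc r ∷ []
  A = descending (suc k′)
  A-valid : ValidA (suc k′) A
  A-valid = descending-valid (suc k′)
  max≡ : maxList H ≡ suc r
  max≡ = m≤n⇒m⊔n≡n (n≤1+n r)
  H-valid : ValidH (suc k′) r H
  H-valid = n<1+n r ∷ [-] , s≤s (s≤s z≤n) , >-nonZero⁻¹ r ∷ s≤s z≤n ∷ [] ,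
            subst (r ≤_) (sym max≡) (n≤1+n r) , subst (_≤ pred (k′ * r)) (sym max≡) (<⇒≤pred 2+r≤k′r)
  lower : 𝓛 (suc k′) H r ℤ.≤ + cardHSumset H r A
  lower = let A! , lenA , A⁺ = A-valid in
          lowerBound A! lenA A⁺ (ValidH⇒0∷increasing {suc k′} {r} H-valid) (ValidH⇒below {suc k′} {r} H-valid)
  H-range : All (λ h → r ≤ h × h ≤ suc r) H
  H-range = (≤-refl , n≤1+n r) ∷ (n≤1+n r , ≤-refl) ∷ []
  bounds : ∀ {v} → v ∈ HSumsetList H r A → r ≤ v × v < r + (k′ * r + suc k′)
  bounds v∈ with h , h∈H , v∈h@(c , _ , len , refl , refl) ← ∈-HSumsetList⁻ {H} {r} {A} v∈ =
    let r≤h , h≤1+r = All.lookup H-range h∈H in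
    ≤-trans r≤h (sum≤dot {c} (proj₂ (proj₂ A-valid)) len) ,
    subst (dot c A <_) (sym (identity k′ r)) (descending-sum-< v∈h h≤1+r)
    where
    identity : ∀ k′ r → r + (k′ * r + suc k′) ≡ suc k′ * suc r
    identity = ℕ-Solver.solve-∀
  upper : + cardHSumset H r A ℤ.≤ 𝓛 (suc k′) H r
  upper = subst (+ cardHSumset H r A ℤ.≤_) (sym (𝓛-extremal k′ r))
            (ℤ.+≤+ (cardHSumset-≤ {H} {r} {A} r (k′ * r + suc k′) bounds))

theorem2p1 :
    ((k : ℕ) → 3 ≤ k → (r : ℕ) → .{{_ : NonZero r}} →
      (A : List ℕ) → ValidA k A → (H : List ℕ) → ValidH k r H →
      𝓛 k H r ℤ.≤ + cardHSumset H r A)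
    ×
    ((k : ℕ) → 3 ≤ k → (r : ℕ) → .{{_ : NonZero r}} →
      Σ (List ℕ) (λ H₀ → ValidH k r H₀) →
      Σ (List ℕ) λ A → Σ (List ℕ) λ H →
        ValidA k A × ValidH k r H × 𝓛 k H r ≡ + cardHSumset H r A)
theorem2p1 =
  (λ k _ r A (A! , lenA , A⁺) H H-valid →
     lowerBound A! lenA A⁺ (ValidH⇒0∷increasing {k} {r} H-valid) (ValidH⇒below {k} {r} H-valid)) ,
  λ where
    (suc k′) (s≤s 2≤k′) r (_ , H₀-valid) →
      descending (suc k′) , r ∷ suc r ∷ [] , extremal (2+r≤k′r 2≤k′ H₀-valid)
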